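{- The logic sBIL fails right deductive uniform interpolation: it is not the case that for every formula $\phi$ and every propositional variable $p$ there is a formula $\chi$ such that (1) $p$ does not occur in $\chi$, (2) $\phi\vdash_s\chi$, and (3) for every formula $\psi$ in which $p$ does not occur, if $\phi\vdash_s\psi$ then $\chi\vdash_s\psi$.
   Context: Fix a countably infinite set $\mathrm{Prop}$ of propositional variables. Bi-intuitionistic formulas are generated by $\phi ::= p \mid \bot \mid \top \mid \phi\wedge\phi \mid \phi\vee\phi \mid \phi\to\phi \mid \phi\prec\phi$ with $p\in\mathrm{Prop}$ ($\prec$ is exclusion). Abbreviations: $\neg\phi := \phi\to\bot$, ${\sim}\phi := \top\prec\phi$. An axiom is any instance of: (A1) $\phi\to(\psi\to\phi)$; (A2) $(\phi\to(\psi\to\chi))\to((\phi\to\psi)\to(\phi\to\chi))$; (A3) $\phi\to(\phi\vee\psi)$; (A4) $\psi\to(\phi\vee\psi)$; (A5) $(\phi\to\chi)\to((\psi\to\chi)\to((\phi\vee\psi)\to\chi))$; (A6) $(\phi\wedge\psi)\to\phi$; (A7) $(\phi\wedge\psi)\to\psi$; (A8) $(\chi\to\phi)\to((\chi\to\psi)\to(\chi\to(\phi\wedge\psi)))$; (A9) $\bot\to\phi$; (A10) $\phi\to\top$; (A11) $\phi\to(\psi\vee(\phi\prec\psi))$; (A12) $(\phi\prec\psi)\to{\sim}(\phi\to\psi)$; (A13) $((\phi\prec\psi)\prec\chi)\to(\phi\prec(\psi\vee\chi))$; (A14) $\neg(\phi\prec\psi)\to(\phi\to\psi)$. sBIL is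 the relation $\Gamma\vdash_s\phi$ holding iff $\Gamma\vdash\phi$ is derivable with: (Ax) $\Gamma\vdash\phi$ for any axiom $\phi$; (El) $\Gamma\vdash\phi$ if $\phi\in\Gamma$; (MP) from $\Gamma\vdash\phi$ and $\Gamma\vdash\phi\to\psi$ infer $\Gamma\vdash\psi$; (sDN) from $\Gamma\vdash\phi$ infer $\Gamma\vdash\neg{\sim}\phi$. We write $\phi\vdash_s\psi$ for $\{\phi\}\vdash_s\psi$. -}

module Defs where

open import Data.Nat using (ℕ)
open import Data.Empty using (⊥)
open import Data.Product using (Σ; _×_)
open import Relation.Nullary using (¬_)
open import Relation.Binary.PropositionalEquality using (_≡_)
open import Level using (0ℓ)
open import Relation.Unary using (Pred; _∈_; ｛_｝)

Var : Set
Var = ℕ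

infixr 30 _∧'_
infixr 25 _∨'_
infixr 20 _⇒_
infixr 20 _≺_

data Form : Set where
  var  : Var → Form
  ⊥'   : Form
  ⊤'   : Form
  _∧'_ : Form → Form → Form
  _∨'_ : Form → Form → Form
  _⇒_  : Form → Form → Form
  _≺_  : Form → Form → Form

¬' : Form → Form
¬' φ = φ ⇒ ⊥'

∼' : Form → Form
∼' φ = ⊤' ≺ φ

data Axiom : Form → Set where
  A1  : ∀ φ ψ → Axiom (φ ⇒ (ψ ⇒ φ))
  A2  : ∀ φ ψ χ → Axiom ((φ ⇒ (ψ ⇒ χ)) ⇒ ((φ ⇒ ψ) ⇒ (φ ⇒ χ)))
  A3  : ∀ φ ψ → Axiom (φ ⇒ (φ ∨' ψ))
  A4  : ∀ φ ψ → Axiom (ψ ⇒ (φ ∨' ψ))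
  A5  : ∀ φ ψ χ → Axiom ((φ ⇒ χ) ⇒ ((ψ ⇒ χ) ⇒ ((φ ∨' ψ) ⇒ χ)))
  A6  : ∀ φ ψ → Axiom ((φ ∧' ψ) ⇒ φ)
  A7  : ∀ φ ψ → Axiom ((φ ∧' ψ) ⇒ ψ)
  A8  : ∀ φ ψ χ → Axiom ((χ ⇒ φ) ⇒ ((χ ⇒ ψ) ⇒ (χ ⇒ (φ ∧' ψ))))
  A9  : ∀ φ → Axiom (⊥' ⇒ φ)
  A10 : ∀ φ → Axiom (φ ⇒ ⊤')
  A11 : ∀ φ ψ → Axiom (φ ⇒ (ψ ∨' (φ ≺ ψ)))
  A12 : ∀ φ ψ → Axiom ((φ ≺ ψ) ⇒ ∼' (φ ⇒ ψ))
  A13 : ∀ φ ψ χ → Axiom (((φ ≺ ψ) ≺ χ) ⇒ (φ ≺ (ψ ∨' χ)))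
  A14 : ∀ φ ψ → Axiom (¬' (φ ≺ ψ) ⇒ (φ ⇒ ψ))

infix 10 _⊢s_
data _⊢s_ (Γ : Pred Form 0ℓ) : Form → Set where
  ax  : ∀ {φ} → Axiom φ → Γ ⊢s φ
  el  : ∀ {φ} → φ ∈ Γ → Γ ⊢s φ
  mp  : ∀ {φ ψ} → Γ ⊢s φ → Γ ⊢s (φ ⇒ ψ) → Γ ⊢s ψ
  sdn : ∀ {φ} → Γ ⊢s φ → Γ ⊢s ¬' (∼' φ)

infix 10 _⊢₁_
_⊢₁_ : Form → Form → Set
φ ⊢₁ ψ = ｛ φ ｝ ⊢s ψ

data Occurs (p : Var) : Form → Set where
  here : Occurs p (var p)
  ∧l : ∀ {a b} → Occurs p a → Occurs p (a ∧' b)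
  ∧r : ∀ {a b} → Occurs p b → Occurs p (a ∧' b)
  ∨l : ∀ {a b} → Occurs p a → Occurs p (a ∨' b)
  ∨r : ∀ {a b} → Occurs p b → Occurs p (a ∨' b)
  ⇒l : ∀ {a b} → Occurs p a → Occurs p (a ⇒ b)
  ⇒r : ∀ {a b} → Occurs p b → Occurs p (a ⇒ b)
  ≺l : ∀ {a b} → Occurs p a → Occurs p (a ≺ b)
  ≺r : ∀ {a b} → Occurs p b → Occurs p (a ≺ b)

RightDeductiveUIP : Set
RightDeductiveUIP =
  (φ : Form) (p : Var) → Σ Form λ χ →
      (¬ Occurs p χ)
    × (φ ⊢₁ χ)
    × ((ψ : Form) → ¬ Occurs p ψ → φ ⊢₁ ψ → χ ⊢₁ ψ)

{-# OPTIONS --safe #-}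
-- φ₀ = (q → p) ∧ (p → ¬∼p) ∧ (p → ¬r) derives every p-free ψₙ = q → (¬∼)ⁿ ¬r, so a uniform
-- interpolant χ would derive them all. On the zigzag frame low 0 ≼ high 0 ≽ low 1 ≼ high 1 ≽ …,
-- a world low i forcing ¬∼a forces a at low (i+1), so ψₙ fails at low 0 once r holds at high n.
-- Yet χ holds throughout that model when n exceeds twice its depth k: within k steps of level 0
-- it agrees off p with a model of φ₀ in which p holds everywhere and r nowhere, and beyond level k
-- with one in which neither p nor q holds; a p-free formula of depth k sees only k steps.
module Submission where

open import Defs
open import Data.Bool using (Bool; true; false; T)
open import Data.Empty using (⊥; ⊥-elim)
open import Data.Nat using (ℕ; zero; suc; _+_; _≤_; _<_; _⊔_; _≟_; _≤?_; s≤s)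
open import Data.Nat.Properties
  using (≤-refl; ≤-reflexive; ≤-trans; ≤-<-trans; <-≤-trans; ≤-pred; n≤1+n; m≤m⊔n; m≤n⊔m;
         m≤n+m; +-monoʳ-≤; +-suc; <⇒≢; ≰⇒>)
open import Data.Product using (∃-syntax; _×_; _,_; proj₁; proj₂)
open import Data.Product.Function.NonDependent.Propositional using (_×-⇔_)
open import Data.Sum using (_⊎_; inj₁; inj₂; [_,_]; map₂)
open import Data.Sum.Function.Propositional using (_⊎-⇔_)
open import Data.Unit using (⊤; tt)
open import Function using (_⇔_; mk⇔; Equivalence; const; id)
open import Function.Related.TypeIsomorphisms using (→-cong-⇔; ¬-cong-⇔)
open import Level using (0ℓ)
open import Relation.Binary.PropositionalEquality using (_≡_; _≢_; refl; sym; subst)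
open import Relation.Nullary using (¬_; Dec; yes; no; does)
open import Relation.Nullary.Decidable
  using (map′; _×-dec_; _⊎-dec_; _→-dec_; ¬?; T?; toSum; decidable-stable; dec-true; dec-false)
open import Relation.Unary using (Pred; Decidable; _∈_)

open Equivalence using (to; from)

¬∼ : Form → Form
¬∼ a = ¬' (∼' a)

¬∼^ : ℕ → Form → Form
¬∼^ zero    a = a
¬∼^ (suc m) a = ¬∼^ m (¬∼ a)

module _ {Γ : Pred Form 0ℓ} where

  ∧-elimˡ : ∀ {a b} → Γ ⊢s a ∧' b → Γ ⊢s a
  ∧-elimˡ a∧b = mp a∧b (ax (A6 _ _))

  ∧-elimʳ : ∀ {a b} → Γ ⊢s a ∧' b → Γ ⊢s b
  ∧-elimʳ a∧b = mp a∧b (ax (A7 _ _))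

  ⇒-trans : ∀ {a b c} → Γ ⊢s a ⇒ b → Γ ⊢s b ⇒ c → Γ ⊢s a ⇒ c
  ⇒-trans {a} {b} {c} a⇒b b⇒c = mp a⇒b (mp (mp b⇒c (ax (A1 (b ⇒ c) a))) (ax (A2 a b c)))

  ⇒-antitoneˡ : ∀ {a b c} → Γ ⊢s a ⇒ b → Γ ⊢s (b ⇒ c) ⇒ (a ⇒ c)
  ⇒-antitoneˡ {a} {b} {c} a⇒b =
    mp (mp a⇒b (ax (A1 (a ⇒ b) (b ⇒ c))))
       (mp (⇒-trans (ax (A1 (b ⇒ c) a)) (ax (A2 a b c))) (ax (A2 (b ⇒ c) (a ⇒ b) (a ⇒ c))))

  ∨-monoˡ : ∀ {a b c} → Γ ⊢s a ⇒ b → Γ ⊢s (a ∨' c) ⇒ (b ∨' c)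
  ∨-monoˡ {a} {b} {c} a⇒b =
    mp (ax (A4 b c)) (mp (⇒-trans a⇒b (ax (A3 b c))) (ax (A5 a c (b ∨' c))))

  -- The one use of sDN: ⊢ a ⇒ b ∨ c gives ⊢ ¬∼(a ⇒ b ∨ c), which refutes (a ≺ b) ≺ c by A13, A12.
  ≺-residual : ∀ {a b c} → Γ ⊢s a ⇒ (b ∨' c) → Γ ⊢s (a ≺ b) ⇒ c
  ≺-residual {a} {b} {c} a⇒b∨c =
    mp (⇒-trans (⇒-trans (ax (A13 a b c)) (ax (A12 a (b ∨' c)))) (sdn a⇒b∨c))
       (ax (A14 (a ≺ b) c))

  ∼-antitone : ∀ {a b} → Γ ⊢s a ⇒ b → Γ ⊢s ∼' b ⇒ ∼' a
  ∼-antitone {a} a⇒b = ≺-residual (⇒-trans (ax (A11 ⊤' a)) (∨-monoˡ a⇒b))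

  ¬∼-mono : ∀ {a b} → Γ ⊢s a ⇒ b → Γ ⊢s ¬∼ a ⇒ ¬∼ b
  ¬∼-mono a⇒b = ⇒-antitoneˡ (∼-antitone a⇒b)

  ⇒-¬∼^ : ∀ {c} → Γ ⊢s c ⇒ ¬∼ c → ∀ m {a} → Γ ⊢s c ⇒ a → Γ ⊢s c ⇒ ¬∼^ m a
  ⇒-¬∼^ c⇒¬∼c zero    c⇒a = c⇒a
  ⇒-¬∼^ c⇒¬∼c (suc m) c⇒a = ⇒-¬∼^ c⇒¬∼c m (⇒-trans c⇒¬∼c (¬∼-mono c⇒a))

¬∼-fresh : ∀ {i a} → ¬ Occurs i a → ¬ Occurs i (¬∼ a)
¬∼-fresh i∉a (⇒l (≺l ()))
¬∼-fresh i∉a (⇒l (≺r i∈a)) = i∉a i∈a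
¬∼-fresh i∉a (⇒r ())

¬∼^-fresh : ∀ {i} m {a} → ¬ Occurs i a → ¬ Occurs i (¬∼^ m a)
¬∼^-fresh zero    i∉a = i∉a
¬∼^-fresh (suc m) i∉a = ¬∼^-fresh m (¬∼-fresh i∉a)

depth : Form → ℕ
depth (var _)  = 0
depth ⊥'       = 0
depth ⊤'       = 0
depth (a ∧' b) = depth a ⊔ depth b
depth (a ∨' b) = depth a ⊔ depth b
depth (a ⇒ b)  = suc (depth a ⊔ depth b)
depth (a ≺ b)  = suc (depth a ⊔ depth b)

p q r : Form
p = var 0
q = var 1
r = var 2

φ₀ : Form
φ₀ = (q ⇒ p) ∧' (p ⇒ ¬∼ p) ∧' (p ⇒ ¬' r)

ψ : ℕ → Form
ψ n = q ⇒ ¬∼^ n (¬' r)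

φ₀⊢ψ : ∀ n → φ₀ ⊢₁ ψ n
φ₀⊢ψ n = ⇒-trans q⇒p (⇒-¬∼^ (∧-elimˡ p⇒rest) n (∧-elimʳ p⇒rest))
  where
    q⇒p : φ₀ ⊢₁ q ⇒ p
    q⇒p = ∧-elimˡ (el refl)

    p⇒rest : φ₀ ⊢₁ (p ⇒ ¬∼ p) ∧' (p ⇒ ¬' r)
    p⇒rest = ∧-elimʳ (el refl)

p∉ψ : ∀ n → ¬ Occurs 0 (ψ n)
p∉ψ n (⇒l ())
p∉ψ n (⇒r p∈) = ¬∼^-fresh n p∉¬r p∈
  where
    p∉¬r : ¬ Occurs 0 (¬' r)
    p∉¬r (⇒l ())
    p∉¬r (⇒r ())

-- Decidability of bounded quantification is what lets forcing be decided, and hence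
-- validates A11 and A14 constructively.
record Frame : Set₁ where
  field
    World      : Set
    _≼_        : World → World → Set
    ≼-refl     : ∀ {w} → w ≼ w
    ≼-trans    : ∀ {u v w} → u ≼ v → v ≼ w → u ≼ w
    all-above? : ∀ {P : Pred World 0ℓ} → Decidable P → ∀ w → Dec (∀ v → w ≼ v → P v)
    any-below? : ∀ {P : Pred World 0ℓ} → Decidable P → ∀ w → Dec (∃[ u ] u ≼ w × P u)

module Kripke (F : Frame) where
  open Frame F

  Valuation : Set
  Valuation = Var → World → Bool

  UpClosed : (World → Bool) → Set
  UpClosed S = ∀ {w v} → w ≼ v → T (S w) → T (S v)

  Persistent : Valuation → Set
  Persistent V = ∀ i → UpClosed (V i)

  infix 4 _⊩[_]_
  _⊩[_]_ : World → Valuation → Form → Set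
  w ⊩[ V ] var i    = T (V i w)
  w ⊩[ V ] ⊥'       = ⊥
  w ⊩[ V ] ⊤'       = ⊤
  w ⊩[ V ] (a ∧' b) = w ⊩[ V ] a × w ⊩[ V ] b
  w ⊩[ V ] (a ∨' b) = w ⊩[ V ] a ⊎ w ⊩[ V ] b
  w ⊩[ V ] (a ⇒ b)  = ∀ v → w ≼ v → v ⊩[ V ] a → v ⊩[ V ] b
  w ⊩[ V ] (a ≺ b)  = ∃[ u ] u ≼ w × u ⊩[ V ] a × ¬ (u ⊩[ V ] b)

  Valid : Valuation → Form → Set
  Valid V a = ∀ w → w ⊩[ V ] a

  ⊩? : ∀ V a w → Dec (w ⊩[ V ] a)
  ⊩? V (var i)  w = T? (V i w)
  ⊩? V ⊥'       w = no id
  ⊩? V ⊤'       w = yes tt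
  ⊩? V (a ∧' b) w = ⊩? V a w ×-dec ⊩? V b w
  ⊩? V (a ∨' b) w = ⊩? V a w ⊎-dec ⊩? V b w
  ⊩? V (a ⇒ b)  w = all-above? (λ v → ⊩? V a v →-dec ⊩? V b v) w
  ⊩? V (a ≺ b)  w = any-below? (λ u → ⊩? V a u ×-dec ¬? (⊩? V b u)) w

  ¬∼-elim : ∀ V {a w v u} → w ⊩[ V ] ¬∼ a → w ≼ v → u ≼ v → u ⊩[ V ] a
  ¬∼-elim V {a} {u = u} w⊩¬∼a w≼v u≼v =
    decidable-stable (⊩? V a u) (λ u⊮a → w⊩¬∼a _ w≼v (u , u≼v , tt , u⊮a))

  module _ {V : Valuation} (persistent : Persistent V) where

    ⊩-mono : ∀ a {w v} → w ≼ v → w ⊩[ V ] a → v ⊩[ V ] a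
    ⊩-mono (var i)  w≼v h              = persistent i w≼v h
    ⊩-mono ⊥'       w≼v ()
    ⊩-mono ⊤'       w≼v h              = tt
    ⊩-mono (a ∧' b) w≼v (ha , hb)      = ⊩-mono a w≼v ha , ⊩-mono b w≼v hb
    ⊩-mono (a ∨' b) w≼v (inj₁ ha)      = inj₁ (⊩-mono a w≼v ha)
    ⊩-mono (a ∨' b) w≼v (inj₂ hb)      = inj₂ (⊩-mono b w≼v hb)
    ⊩-mono (a ⇒ b)  w≼v h              = λ u v≼u → h u (≼-trans w≼v v≼u)
    ⊩-mono (a ≺ b)  w≼v (u , u≼w , h)  = u , ≼-trans u≼w w≼v , h

    axiom-valid : ∀ {a} → Axiom a → Valid V a
    axiom-valid (A1 a b) _ v _ ha u v≼u _ = ⊩-mono a v≼u ha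
    axiom-valid (A2 a b c) _ _ _ h₁ u v≼u h₂ t u≼t ha =
      h₁ t (≼-trans v≼u u≼t) ha t ≼-refl (h₂ t u≼t ha)
    axiom-valid (A3 a b) _ _ _ = inj₁
    axiom-valid (A4 a b) _ _ _ = inj₂
    axiom-valid (A5 a b c) _ _ _ h₁ u v≼u h₂ t u≼t =
      [ h₁ t (≼-trans v≼u u≼t) , h₂ t u≼t ]
    axiom-valid (A6 a b) _ _ _ (ha , _) = ha
    axiom-valid (A7 a b) _ _ _ (_ , hb) = hb
    axiom-valid (A8 a b c) _ _ _ h₁ u v≼u h₂ t u≼t hc =
      h₁ t (≼-trans v≼u u≼t) hc , h₂ t u≼t hc
    axiom-valid (A9 a) _ _ _ ()
    axiom-valid (A10 a) _ _ _ _ = tt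
    axiom-valid (A11 a b) _ v _ ha = map₂ (λ v⊮b → v , ≼-refl , ha , v⊮b) (toSum (⊩? V b v))
    axiom-valid (A12 a b) _ _ _ (u , u≼v , ha , u⊮b) = u , u≼v , tt , λ a⇒b → u⊮b (a⇒b u ≼-refl ha)
    axiom-valid (A13 a b c) _ _ _ (u , u≼v , (t , t≼u , ha , t⊮b) , u⊮c) =
      t , ≼-trans t≼u u≼v , ha , [ t⊮b , (λ hc → u⊮c (⊩-mono c t≼u hc)) ]
    axiom-valid (A14 a b) _ _ _ h u v≼u ha =
      decidable-stable (⊩? V b u) (λ u⊮b → h u v≼u (u , ≼-refl , ha , u⊮b))

    sound : ∀ {Γ a} → (∀ {g} → g ∈ Γ → Valid V g) → Γ ⊢s a → Valid V a
    sound ⊨Γ (ax A)      w = axiom-valid A w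
    sound ⊨Γ (el g∈Γ)    w = ⊨Γ g∈Γ w
    sound ⊨Γ (mp ⊢a ⊢ab) w = sound ⊨Γ ⊢ab w w ≼-refl (sound ⊨Γ ⊢a w)
    sound ⊨Γ (sdn ⊢a)    w = λ { _ _ (u , _ , _ , u⊮a) → u⊮a (sound ⊨Γ ⊢a u) }

    sound₁ : ∀ {c a} → Valid V c → c ⊢₁ a → Valid V a
    sound₁ ⊨c = sound λ { refl → ⊨c }

  -- A formula of depth ≤ k evaluated at w only inspects worlds reachable from w in k
  -- steps along ≼ and its converse; Near k w says the valuations agree (off i) on all of them.
  module _ {V₁ V₂ : Valuation} {i : Var} (Near : ℕ → Pred World 0ℓ)
           (near-agree : ∀ {k w} → Near k w → ∀ j → j ≢ i → V₁ j w ≡ V₂ j w)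
           (near-up    : ∀ k {w v} → Near (suc k) w → w ≼ v → Near k v)
           (near-down  : ∀ k {w v} → Near (suc k) w → v ≼ w → Near k v) where

    forcing-agrees : ∀ a {k w} → ¬ Occurs i a → depth a ≤ k → Near k w →
                     w ⊩[ V₁ ] a ⇔ w ⊩[ V₂ ] a
    forcing-agrees (var j) i∉a _ near
      with near-agree near j (λ { refl → i∉a here })
    ... | V₁≡V₂ = mk⇔ (subst T V₁≡V₂) (subst T (sym V₁≡V₂))
    forcing-agrees ⊥' _ _ _ = mk⇔ id id
    forcing-agrees ⊤' _ _ _ = mk⇔ id id
    forcing-agrees (a ∧' b) i∉a d≤k near =
      forcing-agrees a (λ o → i∉a (∧l o)) (≤-trans (m≤m⊔n _ _) d≤k) near
        ×-⇔ forcing-agrees b (λ o → i∉a (∧r o)) (≤-trans (m≤n⊔m _ _) d≤k) near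
    forcing-agrees (a ∨' b) i∉a d≤k near =
      forcing-agrees a (λ o → i∉a (∨l o)) (≤-trans (m≤m⊔n _ _) d≤k) near
        ⊎-⇔ forcing-agrees b (λ o → i∉a (∨r o)) (≤-trans (m≤n⊔m _ _) d≤k) near
    forcing-agrees (a ⇒ b) i∉a (s≤s d≤k) near =
      mk⇔ (λ h v w≼v → to (at v w≼v) (h v w≼v)) (λ h v w≼v → from (at v w≼v) (h v w≼v))
      where
        at : ∀ v → _ ≼ v → (v ⊩[ V₁ ] a → v ⊩[ V₁ ] b) ⇔ (v ⊩[ V₂ ] a → v ⊩[ V₂ ] b)
        at v w≼v = →-cong-⇔
          (forcing-agrees a (λ o → i∉a (⇒l o)) (≤-trans (m≤m⊔n _ _) d≤k) (near-up _ near w≼v))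
          (forcing-agrees b (λ o → i∉a (⇒r o)) (≤-trans (m≤n⊔m _ _) d≤k) (near-up _ near w≼v))
    forcing-agrees (a ≺ b) i∉a (s≤s d≤k) near =
      mk⇔ (λ (u , u≼w , h) → u , u≼w , to (at u u≼w) h)
          (λ (u , u≼w , h) → u , u≼w , from (at u u≼w) h)
      where
        at : ∀ u → u ≼ _ → (u ⊩[ V₁ ] a × ¬ u ⊩[ V₁ ] b) ⇔ (u ⊩[ V₂ ] a × ¬ u ⊩[ V₂ ] b)
        at u u≼w =
          forcing-agrees a (λ o → i∉a (≺l o)) (≤-trans (m≤m⊔n _ _) d≤k) (near-down _ near u≼w)
            ×-⇔ ¬-cong-⇔
          (forcing-agrees b (λ o → i∉a (≺r o)) (≤-trans (m≤n⊔m _ _) d≤k) (near-down _ near u≼w))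

data Zigzag : Set where
  low high : ℕ → Zigzag

infix 4 _≼ᶻ_
data _≼ᶻ_ : Zigzag → Zigzag → Set where
  self     : ∀ {w} → w ≼ᶻ w
  vertical : ∀ i → low i ≼ᶻ high i
  diagonal : ∀ i → low (suc i) ≼ᶻ high i

≼ᶻ-trans : ∀ {u v w} → u ≼ᶻ v → v ≼ᶻ w → u ≼ᶻ w
≼ᶻ-trans self         v≼w = v≼w
≼ᶻ-trans (vertical i) self = vertical i
≼ᶻ-trans (diagonal i) self = diagonal i

all-above-zigzag? : ∀ {P : Pred Zigzag 0ℓ} → Decidable P → ∀ w → Dec (∀ v → w ≼ᶻ v → P v)
all-above-zigzag? P? (high i) =
  map′ (λ Pw → λ { _ self → Pw }) (λ all → all _ self) (P? (high i))
all-above-zigzag? P? (low zero) =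
  map′ (λ (P₀ , P₁) → λ { _ self → P₀ ; _ (vertical _) → P₁ })
       (λ all → all _ self , all _ (vertical 0))
       (P? (low 0) ×-dec P? (high 0))
all-above-zigzag? P? (low (suc i)) =
  map′ (λ (P₀ , P₁ , P₂) → λ { _ self → P₀ ; _ (vertical _) → P₁ ; _ (diagonal _) → P₂ })
       (λ all → all _ self , all _ (vertical (suc i)) , all _ (diagonal i))
       (P? (low (suc i)) ×-dec P? (high (suc i)) ×-dec P? (high i))

any-below-zigzag? : ∀ {P : Pred Zigzag 0ℓ} → Decidable P → ∀ w → Dec (∃[ u ] u ≼ᶻ w × P u)
any-below-zigzag? P? (low i) =
  map′ (λ Pw → _ , self , Pw) (λ { (_ , self , Pw) → Pw }) (P? (low i))
any-below-zigzag? P? (high i) =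
  map′ [ (λ P₀ → _ , self , P₀) , [ (λ P₁ → _ , vertical i , P₁) , (λ P₂ → _ , diagonal i , P₂) ] ]
       (λ { (_ , self , P₀) → inj₁ P₀ ; (_ , vertical _ , P₁) → inj₂ (inj₁ P₁)
          ; (_ , diagonal _ , P₂) → inj₂ (inj₂ P₂) })
       (P? (high i) ⊎-dec P? (low i) ⊎-dec P? (low (suc i)))

zigzag : Frame
zigzag = record
  { World      = Zigzag
  ; _≼_        = _≼ᶻ_
  ; ≼-refl     = self
  ; ≼-trans    = ≼ᶻ-trans
  ; all-above? = all-above-zigzag?
  ; any-below? = any-below-zigzag?
  }

open Kripke zigzag

level : Zigzag → ℕ
level (low i)  = i
level (high i) = i

≼ᶻ-level : ∀ {w v} → w ≼ᶻ v → level v ≤ suc (level w) × level w ≤ suc (level v)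
≼ᶻ-level self         = n≤1+n _ , n≤1+n _
≼ᶻ-level (vertical i) = n≤1+n _ , n≤1+n _
≼ᶻ-level (diagonal i) = ≤-trans (n≤1+n _) (n≤1+n _) , ≤-refl

valuation : (P Q R : Zigzag → Bool) → Valuation
valuation P Q R 0                   = P
valuation P Q R 1                   = Q
valuation P Q R 2                   = R
valuation P Q R (suc (suc (suc _))) = const false

valuation-persistent : ∀ {P Q R} → UpClosed P → UpClosed Q → UpClosed R →
                       Persistent (valuation P Q R)
valuation-persistent P↑ Q↑ R↑ 0                   = P↑
valuation-persistent P↑ Q↑ R↑ 1                   = Q↑
valuation-persistent P↑ Q↑ R↑ 2                   = R↑
valuation-persistent P↑ Q↑ R↑ (suc (suc (suc _))) = λ _ ()

const-up-closed : ∀ b → UpClosed (const b)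
const-up-closed b _ = id

level₀ : Zigzag → Bool
level₀ (low zero)  = true
level₀ (high zero) = true
level₀ _           = false

level₀-up-closed : UpClosed level₀
level₀-up-closed self              = id
level₀-up-closed (vertical zero)   = id
level₀-up-closed (vertical (suc i)) ()
level₀-up-closed (diagonal i)       ()

highAt : ℕ → Zigzag → Bool
highAt n (low _)  = false
highAt n (high i) = does (i ≟ n)

highAt-up-closed : ∀ n → UpClosed (highAt n)
highAt-up-closed n self         = id
highAt-up-closed n (vertical i) ()
highAt-up-closed n (diagonal i) ()

Mnear : Valuation
Mnear = valuation (const true) level₀ (const false)

Mfar : ℕ → Valuation
Mfar n = valuation (const false) (const false) (highAt n)

Mglued : ℕ → Valuation
Mglued n = valuation (const false) level₀ (highAt n)

Mnear-persistent : Persistent Mnear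
Mnear-persistent = valuation-persistent (const-up-closed true) level₀-up-closed (const-up-closed false)

Mfar-persistent : ∀ n → Persistent (Mfar n)
Mfar-persistent n =
  valuation-persistent (const-up-closed false) (const-up-closed false) (highAt-up-closed n)

Mglued-persistent : ∀ n → Persistent (Mglued n)
Mglued-persistent n = valuation-persistent (const-up-closed false) level₀-up-closed (highAt-up-closed n)

φ₀-valid-near : Valid Mnear φ₀
φ₀-valid-near _ =
  (λ _ _ _ → tt) , (λ { _ _ _ _ _ (_ , _ , _ , t⊮p) → t⊮p tt }) , (λ { _ _ _ _ _ () })

φ₀-valid-far : ∀ n → Valid (Mfar n) φ₀
φ₀-valid-far n _ = (λ { _ _ () }) , (λ { _ _ () }) , (λ { _ _ () })

low-¬∼^ : ∀ {V} m {a} → low 0 ⊩[ V ] ¬∼^ m a → low m ⊩[ V ] a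
low-¬∼^     zero        h = h
low-¬∼^ {V} (suc m) {a} h = ¬∼-elim V {a} (low-¬∼^ m h) (vertical m) (diagonal m)

ψ-fails : ∀ n → ¬ (low 0 ⊩[ Mglued n ] ψ n)
ψ-fails n h = low-¬∼^ n (h (low 0) self tt) (high n) (vertical n) r-at-high
  where
    r-at-high : T (does (n ≟ n))
    r-at-high = subst T (sym (dec-true (n ≟ n) refl)) tt

module _ (n : ℕ) where

  NearZero : ℕ → Pred Zigzag 0ℓ
  NearZero k w = k + level w < n

  FarFromZero : ℕ → Pred Zigzag 0ℓ
  FarFromZero k w = k < level w

  near-zero-agree : ∀ {k w} → NearZero k w → ∀ j → j ≢ 0 → Mglued n j w ≡ Mnear j w
  near-zero-agree                  _    0                   j≢0 = ⊥-elim (j≢0 refl)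
  near-zero-agree                  _    1                   _   = refl
  near-zero-agree {w = low _}      _    2                   _   = refl
  near-zero-agree {k} {high i}     near 2                   _   =
    dec-false (i ≟ n) (<⇒≢ (≤-<-trans (m≤n+m i k) near))
  near-zero-agree                  _    (suc (suc (suc _))) _   = refl

  far-from-zero-agree : ∀ {k w} → FarFromZero k w → ∀ j → j ≢ 0 → Mglued n j w ≡ Mfar n j w
  far-from-zero-agree                    _ 0                   _ = refl
  far-from-zero-agree {w = low (suc _)}  _ 1                   _ = refl
  far-from-zero-agree {w = high (suc _)} _ 1                   _ = refl
  far-from-zero-agree                    _ 2                   _ = refl
  far-from-zero-agree                    _ (suc (suc (suc _))) _ = refl

  near-zero-up : ∀ k {w v} → NearZero (suc k) w → w ≼ᶻ v → NearZero k v
  near-zero-up k {w} near w≼v =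
    ≤-<-trans (≤-trans (+-monoʳ-≤ k (proj₁ (≼ᶻ-level w≼v))) (≤-reflexive (+-suc k (level w)))) near

  near-zero-down : ∀ k {w v} → NearZero (suc k) w → v ≼ᶻ w → NearZero k v
  near-zero-down k {w} near v≼w =
    ≤-<-trans (≤-trans (+-monoʳ-≤ k (proj₂ (≼ᶻ-level v≼w))) (≤-reflexive (+-suc k (level w)))) near

  far-from-zero-up : ∀ k {w v} → FarFromZero (suc k) w → w ≼ᶻ v → FarFromZero k v
  far-from-zero-up k far w≼v = ≤-pred (<-≤-trans far (proj₂ (≼ᶻ-level w≼v)))

  far-from-zero-down : ∀ k {w v} → FarFromZero (suc k) w → v ≼ᶻ w → FarFromZero k v
  far-from-zero-down k far v≼w = ≤-pred (<-≤-trans far (proj₁ (≼ᶻ-level v≼w)))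

  glued-valid : ∀ {a} → ¬ Occurs 0 a → depth a + depth a < n →
                Valid Mnear a → Valid (Mfar n) a → Valid (Mglued n) a
  glued-valid {a} p∉a 2k<n near-valid far-valid w with level w ≤? depth a
  ... | yes lw≤k =
    from (forcing-agrees NearZero near-zero-agree near-zero-up near-zero-down
            a p∉a ≤-refl (≤-<-trans (+-monoʳ-≤ (depth a) lw≤k) 2k<n))
         (near-valid w)
  ... | no lw≰k =
    from (forcing-agrees FarFromZero far-from-zero-agree far-from-zero-up far-from-zero-down
            a p∉a ≤-refl (≰⇒> lw≰k))
         (far-valid w)

interpolant-valid-glued : ∀ {χ} → ¬ Occurs 0 χ → φ₀ ⊢₁ χ →
                          Valid (Mglued (suc (depth χ + depth χ))) χ
interpolant-valid-glued {χ} p∉χ φ₀⊢χ =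
  glued-valid (suc (depth χ + depth χ)) p∉χ ≤-refl
    (sound₁ Mnear-persistent φ₀-valid-near φ₀⊢χ)
    (sound₁ (Mfar-persistent _) (φ₀-valid-far _) φ₀⊢χ)

φ₀-has-no-uniform-interpolant : ∀ χ → ¬ Occurs 0 χ → φ₀ ⊢₁ χ →
                                ¬ (∀ a → ¬ Occurs 0 a → φ₀ ⊢₁ a → χ ⊢₁ a)
φ₀-has-no-uniform-interpolant χ p∉χ φ₀⊢χ χ-least =
  ψ-fails n (sound₁ (Mglued-persistent n) (interpolant-valid-glued p∉χ φ₀⊢χ)
                    (χ-least (ψ n) (p∉ψ n) (φ₀⊢ψ n)) (low 0))
  where
    n = suc (depth χ + depth χ)

mainTheorem9 : ¬ RightDeductiveUIP
mainTheorem9 uip =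
  let (χ , p∉χ , φ₀⊢χ , χ-least) = uip φ₀ 0
  in φ₀-has-no-uniform-interpolant χ p∉χ φ₀⊢χ χ-least
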